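{- For every integer $r\geqslant 1$, \[Z\left(\mathrm{BF}(r)\right)\leqslant\frac19\left[(3r+7)2^r+2(-1)^r\right].\]
   Context: The butterfly network $\mathrm{BF}(r)$ has vertex set $\bigcup_{i=0}^r V_i$ with $V_i=\{(x,i): x\in\{0,\dots,2^r-1\}\}$, each $x$ identified with the binary vector $(x_1,\dots,x_r)$ with $x=\sum_j x_j2^{j-1}$; edges join $(x,i-1)$ and $(y,i)$ for $1\leqslant i\leqslant r$ and $y\in\{x,x+e_i\}$ (addition modulo 2, $e_i$ the $i$-th unit vector). Zero forcing: starting with a set $S$ of colored vertices, an uncolored vertex becomes colored if it is the only uncolored neighbor of some colored vertex; $S$ is zero forcing if repeatedly applying this rule colors every vertex. $Z(G)$ is the minimum size of a zero forcing set of $G$. -}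

module Defs where

open import Level using (Level; _⊔_; suc)
open import Data.Nat using (ℕ; _^_; _≤_)
open import Data.Bool using (Bool; not)
open import Data.Fin using (Fin; inject₁) renaming (suc to fsuc)
open import Data.Vec using (Vec; updateAt)
open import Data.Product using (Σ; _×_; _,_)
open import Data.Sum using (_⊎_)
open import Data.List using (List; length)
open import Data.List.Membership.Propositional using (_∈_)
open import Data.List.Relation.Unary.Unique.Propositional using (Unique)
open import Relation.Binary.PropositionalEquality using (_≡_; _≢_)

-- Vertices colored by repeatedly applying the color-change rule, starting
-- from the list S: v becomes colored if some colored u is adjacent to v
-- and every neighbour w ≠ v of u is already colored.  (The least set closed
-- under the rule = the final result of the forcing process.)
data Colored {a ℓ} {V : Set a} (Adj : V → V → Set ℓ) (S : List V) : V → Set (a ⊔ ℓ) where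
  initial : ∀ {v} → v ∈ S → Colored Adj S v
  force   : ∀ {u v} → Colored Adj S u → Adj u v →
            (∀ w → Adj u w → w ≢ v → Colored Adj S w) →
            Colored Adj S v

IsZeroForcing : ∀ {a ℓ} {V : Set a} (Adj : V → V → Set ℓ) → List V → Set (a ⊔ ℓ)
IsZeroForcing Adj S = ∀ v → Colored Adj S v

-- Z(G) ≤ k : some zero forcing set (list without repetitions) has size ≤ k.
-- (Z is defined as a minimum; Z ≤ k unfolds to this.)
ZeroForcingNumber≤ : ∀ {a ℓ} {V : Set a} (Adj : V → V → Set ℓ) → ℕ → Set (a ⊔ ℓ)
ZeroForcingNumber≤ {V = V} Adj k =
  Σ (List V) λ S → Unique S × IsZeroForcing Adj S × (length S ≤ k)

-- Butterfly network BF(r).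
-- A vertex (x , i) has level i ∈ {0..r} and x ∈ {0..2^r-1} identified with
-- its binary vector (x_1,…,x_r); position j of the Vec holds x_{j+1}.

BFVertex : ℕ → Set
BFVertex r = Fin (ℕ.suc r) × Vec Bool r

flipBit : ∀ {r} → Vec Bool r → Fin r → Vec Bool r
flipBit x j = updateAt x j not

-- directed edge (x , i-1) → (y , i) with i = j+1, y ∈ {x , x + e_i}
BFEdge : (r : ℕ) → BFVertex r → BFVertex r → Set
BFEdge r (i , x) (i' , y) =
  Σ (Fin r) λ j → i ≡ inject₁ j × i' ≡ fsuc j × (y ≡ x ⊎ y ≡ flipBit x j)

BFAdj : (r : ℕ) → BFVertex r → BFVertex r → Set
BFAdj r u v = BFEdge r u v ⊎ BFEdge r v u

-- Levels 1, …, r+1 of BF(r+1) form two copies of BF(r), told apart by the first bit.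
-- Seed BF(r+1) with the level-0 vertices whose word has an even number of leading
-- ones, the seeds of BF(r) in copy 0, and the seeds of BF(r) above level 0 in copy 1.
-- A forcing process of BF(r) in which the level-0 seeds never force replays inside
-- copy 0, because the only new neighbours of a copied vertex (0, x) are (0, c ∷ x),
-- and these are seeds whenever (0, x) is not.  Copy 0's vertex above y then forces
-- (0, 1 ∷ y); for even y this vertex is not a seed and forces copy 1's vertex above y,
-- after which copy 1 replays too.  The number E(r) of even words satisfies
-- E(r) + E(r+1) = 2^(r+1), so 3E(r) = 2^(r+1) + (-1)^r, and the number S(r) of seeds
-- satisfies 3S(r) = (r+1)2^r + 2E(r); together 9S(r) = (3r+7)2^r + 2(-1)^r.

module Submission where

open import Defs
open import Data.Nat using (ℕ; _≤_; _+_; _*_; _^_)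
open import Data.Product using (Σ; _×_)
open import Data.Integer using (ℤ; +_; -[1+_]) renaming (_≤_ to _≤ℤ_; _+_ to _+ℤ_; _*_ to _*ℤ_; _^_ to _^ℤ_)

open import Level using (_⊔_)
open import Function using (_∘_)
open import Data.Nat using (zero; suc)
open import Data.Nat.Properties using (+-identityʳ; +-comm; *-distribˡ-+)
import Data.Nat.Tactic.RingSolver as ℕ-Solver
open import Data.Integer using (-1ℤ) renaming (_-_ to _-ℤ_)
open import Data.Integer.Properties using (pos-+; pos-*; ≤-reflexive)
import Data.Integer.Tactic.RingSolver as ℤ-Solver
open import Data.Bool using (Bool; true; false; not)
import Data.Bool.Properties as Bool
open import Data.Fin using (Fin) renaming (zero to fzero; suc to fsuc)
import Data.Fin.Properties as Fin
open import Data.Vec using (Vec; []; _∷_)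
import Data.Vec.Properties as Vec
open import Data.Product using (_,_)
import Data.Product.Properties as Product
open import Data.Sum using (_⊎_; inj₁; inj₂)
open import Data.Empty using (⊥-elim)
open import Data.List using (List; []; _∷_; map; _++_; length; deduplicate)
open import Data.List.Properties using (length-++; length-map; length-deduplicate)
open import Data.List.Relation.Unary.Any using (here)
open import Data.List.Membership.Propositional using (_∈_)
open import Data.List.Relation.Binary.Subset.Propositional using (_⊆_)
open import Data.List.Membership.Propositional.Properties using (∈-map⁺; ∈-++⁺ˡ; ∈-++⁺ʳ; ∈-deduplicate⁺)
open import Data.List.Relation.Unary.Unique.DecPropositional.Properties using (deduplicate-!)
open import Relation.Nullary using (¬_)
open import Relation.Binary.Definitions using (DecidableEquality)
open import Relation.Binary.PropositionalEquality

module _ {a ℓ} {V : Set a} {Adj : V → V → Set ℓ} where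

  Colored-mono : ∀ {S T} → S ⊆ T → ∀ {v} → Colored Adj S v → Colored Adj T v
  Colored-mono S⊆T (initial v∈S)        = initial (S⊆T v∈S)
  Colored-mono S⊆T (force cu uv others) =
    force (Colored-mono S⊆T cu) uv (λ w uw w≢v → Colored-mono S⊆T (others w uw w≢v))

  zeroForcingNumber≤length : DecidableEquality V → ∀ S → IsZeroForcing Adj S →
                             ZeroForcingNumber≤ Adj (length S)
  zeroForcingNumber≤length _≟_ S zf =
    deduplicate _≟_ S , deduplicate-! _≟_ S ,
    (λ v → Colored-mono (∈-deduplicate⁺ _≟_) (zf v)) ,
    length-deduplicate _≟_ S

data ActivelyColored {a ℓ p} {V : Set a} (Adj : V → V → Set ℓ) (Seed Passive : V → Set p)
     : V → Set (a ⊔ ℓ ⊔ p) where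
  seeded : ∀ {v} → Seed v → ActivelyColored Adj Seed Passive v
  forced : ∀ {u v} → ActivelyColored Adj Seed Passive u → ¬ Passive u → Adj u v →
           (∀ w → Adj u w → w ≢ v → ActivelyColored Adj Seed Passive w) →
           ActivelyColored Adj Seed Passive v

ActivelyColored⇒Colored : ∀ {a ℓ p} {V : Set a} {Adj : V → V → Set ℓ} {Seed Passive : V → Set p} {S} →
                          (∀ {v} → Seed v → v ∈ S) →
                          ∀ {v} → ActivelyColored Adj Seed Passive v → Colored Adj S v
ActivelyColored⇒Colored seed∈S (seeded s) = initial (seed∈S s)
ActivelyColored⇒Colored seed∈S (forced cu _ uv others) =
  force (ActivelyColored⇒Colored seed∈S cu) uv
        (λ w uw w≢v → ActivelyColored⇒Colored seed∈S (others w uw w≢v))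

module _ {a b ℓ ℓ′ p p′} {V : Set a} {W : Set b}
         {AdjV : V → V → Set ℓ} {AdjW : W → W → Set ℓ′}
         {SeedV PassiveV : V → Set p} {SeedW PassiveW : W → Set p′} where

  ActivelyColored-map :
    (f : V → W) →
    (∀ {u v} → AdjV u v → AdjW (f u) (f v)) →
    (∀ {u} → ¬ PassiveV u → ¬ PassiveW (f u)) →
    (∀ {u} w → ¬ PassiveV u → AdjW (f u) w →
       (Σ V λ v → w ≡ f v × AdjV u v) ⊎ ActivelyColored AdjW SeedW PassiveW w) →
    (∀ {v} → SeedV v → ActivelyColored AdjW SeedW PassiveW (f v)) →
    ∀ {v} → ActivelyColored AdjV SeedV PassiveV v → ActivelyColored AdjW SeedW PassiveW (f v)
  ActivelyColored-map f f-adj f-active new-colored seeds-colored = go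
    where
    go : ∀ {v} → ActivelyColored AdjV SeedV PassiveV v → ActivelyColored AdjW SeedW PassiveW (f v)
    go (seeded s) = seeds-colored s
    go {v} (forced {u} cu active uv others) = forced (go cu) (f-active active) (f-adj uv) others′
      where
      others′ : ∀ w → AdjW (f u) w → w ≢ f v → ActivelyColored AdjW SeedW PassiveW w
      others′ w uw w≢fv with new-colored w active uw
      ... | inj₁ (w′ , refl , uw′) = go (others w′ uw′ (w≢fv ∘ cong f))
      ... | inj₂ colored = colored

BFAdj-sym : ∀ {r} {u v : BFVertex r} → BFAdj r u v → BFAdj r v u
BFAdj-sym (inj₁ e) = inj₂ e
BFAdj-sym (inj₂ e) = inj₁ e

bottom : ∀ {r} → Vec Bool r → BFVertex r
bottom y = fzero , y

copy : ∀ {r} → Bool → BFVertex r → BFVertex (suc r)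
copy b (i , x) = fsuc i , b ∷ x

copy-edge : ∀ {r} b {u v : BFVertex r} → BFEdge r u v → BFEdge (suc r) (copy b u) (copy b v)
copy-edge b (j , refl , refl , inj₁ refl) = fsuc j , refl , refl , inj₁ refl
copy-edge b (j , refl , refl , inj₂ refl) = fsuc j , refl , refl , inj₂ refl

copy-adj : ∀ {r} b {u v : BFVertex r} → BFAdj r u v → BFAdj (suc r) (copy b u) (copy b v)
copy-adj b (inj₁ e) = inj₁ (copy-edge b e)
copy-adj b (inj₂ e) = inj₂ (copy-edge b e)

copy-neighbour : ∀ {r} b (i : Fin (suc r)) (x : Vec Bool r) w → BFAdj (suc r) (copy b (i , x)) w →
                 (Σ (BFVertex r) λ w′ → w ≡ copy b w′ × BFAdj r (i , x) w′) ⊎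
                 (i ≡ fzero × Σ Bool λ c → w ≡ bottom (c ∷ x))
copy-neighbour _ _ _ _ (inj₁ (fzero , () , _))
copy-neighbour _ _ _ _ (inj₁ (fsuc j , refl , refl , inj₁ refl)) =
  inj₁ (_ , refl , inj₁ (j , refl , refl , inj₁ refl))
copy-neighbour _ _ _ _ (inj₁ (fsuc j , refl , refl , inj₂ refl)) =
  inj₁ (_ , refl , inj₁ (j , refl , refl , inj₂ refl))
copy-neighbour _ _ _ (_ , c ∷ _) (inj₂ (fzero , refl , refl , inj₁ refl)) = inj₂ (refl , c , refl)
copy-neighbour _ _ _ (_ , c ∷ _) (inj₂ (fzero , refl , refl , inj₂ refl)) = inj₂ (refl , c , refl)
copy-neighbour _ _ _ (_ , _ ∷ _) (inj₂ (fsuc j , refl , refl , inj₁ refl)) =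
  inj₁ (_ , refl , inj₂ (j , refl , refl , inj₁ refl))
copy-neighbour _ _ _ (_ , _ ∷ _) (inj₂ (fsuc j , refl , refl , inj₂ refl)) =
  inj₁ (_ , refl , inj₂ (j , refl , refl , inj₂ refl))

bottom-neighbour : ∀ {r} c (y : Vec Bool r) w → BFAdj (suc r) (bottom (c ∷ y)) w →
                   Σ Bool λ d → w ≡ copy d (bottom y)
bottom-neighbour c _ _ (inj₁ (fzero , refl , refl , inj₁ refl)) = c , refl
bottom-neighbour c _ _ (inj₁ (fzero , refl , refl , inj₂ refl)) = not c , refl
bottom-neighbour _ _ _ (inj₂ (_ , _ , () , _))

bottom-adj-copy : ∀ {r} c d (y : Vec Bool r) → BFAdj (suc r) (bottom (c ∷ y)) (copy d (bottom y))
bottom-adj-copy false false _ = inj₁ (fzero , refl , refl , inj₁ refl)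
bottom-adj-copy false true  _ = inj₁ (fzero , refl , refl , inj₂ refl)
bottom-adj-copy true  false _ = inj₁ (fzero , refl , refl , inj₂ refl)
bottom-adj-copy true  true  _ = inj₁ (fzero , refl , refl , inj₁ refl)

evenLeadingOnes : ∀ {r} → Vec Bool r → Bool
evenLeadingOnes []          = true
evenLeadingOnes (false ∷ y) = true
evenLeadingOnes (true ∷ y)  = not (evenLeadingOnes y)

isSeed : ∀ {r} → BFVertex r → Bool
isSeed (fzero , y)                        = evenLeadingOnes y
isSeed {zero}  (fsuc () , _)
isSeed {suc r} (fsuc i , false ∷ y)        = isSeed (i , y)
isSeed {suc r} (fsuc fzero , true ∷ y)     = false
isSeed {suc r} (fsuc (fsuc i) , true ∷ y)  = isSeed (fsuc i , y)

-- The level-0 seeds gain two new neighbours when BF(r) is copied into BF(r+1),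
-- so forcing processes that are to be copied must not use them.
Passive : ∀ {r} → BFVertex r → Set
Passive (i , y) = i ≡ fzero × evenLeadingOnes y ≡ true

BFColored : ∀ r → BFVertex r → Set
BFColored r = ActivelyColored (BFAdj r) (λ v → isSeed v ≡ true) Passive

bottom-extension-isSeed : ∀ {r} {y : Vec Bool r} → ¬ Passive (bottom y) →
                          ∀ c → isSeed (bottom (c ∷ y)) ≡ true
bottom-extension-isSeed     active false = refl
bottom-extension-isSeed {y = y} active true with evenLeadingOnes y
... | true  = ⊥-elim (active (refl , refl))
... | false = refl

copy-colored : ∀ {r} b → (∀ {v} → isSeed v ≡ true → BFColored (suc r) (copy b v)) →
               ∀ {v} → BFColored r v → BFColored (suc r) (copy b v)
copy-colored {r} b seeds-colored =
  ActivelyColored-map (copy b) (copy-adj b) (λ _ ()) new-colored seeds-colored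
  where
  new-colored : ∀ {u} w → ¬ Passive u → BFAdj (suc r) (copy b u) w →
                (Σ (BFVertex r) λ w′ → w ≡ copy b w′ × BFAdj r u w′) ⊎ BFColored (suc r) w
  new-colored {i , x} w active uw with copy-neighbour b i x w uw
  ... | inj₁ old               = inj₁ old
  ... | inj₂ (refl , c , refl) = inj₂ (seeded (bottom-extension-isSeed active c))

module _ {r} (coloredʳ : ∀ v → BFColored r v) where

  copy₀-colored : ∀ v → BFColored (suc r) (copy false v)
  copy₀-colored v = copy-colored false seeded (coloredʳ v)

  flipped-bottom-colored : ∀ y → BFColored (suc r) (bottom (true ∷ y))
  flipped-bottom-colored y =
    forced (copy₀-colored (bottom y)) (λ ()) (BFAdj-sym (bottom-adj-copy true false y)) others
    where
    others : ∀ w → BFAdj (suc r) (copy false (bottom y)) w → w ≢ bottom (true ∷ y) →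
             BFColored (suc r) w
    others w uw w≢v with copy-neighbour false fzero y w uw
    ... | inj₁ (w′ , refl , _)       = copy₀-colored w′
    ... | inj₂ (refl , false , refl) = seeded refl
    ... | inj₂ (refl , true , refl)  = ⊥-elim (w≢v refl)

  copy₁-bottom-colored : ∀ y → evenLeadingOnes y ≡ true → BFColored (suc r) (copy true (bottom y))
  copy₁-bottom-colored y even =
    forced (flipped-bottom-colored y) active (bottom-adj-copy true true y) others
    where
    active : ¬ Passive (bottom (true ∷ y))
    active (_ , odd) with trans (sym (cong not even)) odd
    ... | ()
    others : ∀ w → BFAdj (suc r) (bottom (true ∷ y)) w → w ≢ copy true (bottom y) →
             BFColored (suc r) w
    others w uw w≢v with bottom-neighbour true y w uw
    ... | false , refl = copy₀-colored _
    ... | true , refl  = ⊥-elim (w≢v refl)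

  copy₁-colored : ∀ v → BFColored (suc r) (copy true v)
  copy₁-colored v = copy-colored true seeds-colored (coloredʳ v)
    where
    seeds-colored : ∀ {v} → isSeed v ≡ true → BFColored (suc r) (copy true v)
    seeds-colored {fzero , y}  = copy₁-bottom-colored y
    seeds-colored {fsuc i , y} = seeded

  colored-suc : ∀ v → BFColored (suc r) v
  colored-suc (fzero , false ∷ y) = seeded refl
  colored-suc (fzero , true ∷ y)  = flipped-bottom-colored y
  colored-suc (fsuc i , false ∷ y) = copy₀-colored (i , y)
  colored-suc (fsuc i , true ∷ y)  = copy₁-colored (i , y)

BF-colored : ∀ r v → BFColored r v
BF-colored zero    (fzero , []) = seeded refl
BF-colored (suc r) = colored-suc (BF-colored r)

bitVectors : ∀ r → List (Vec Bool r)
bitVectors zero    = [] ∷ []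
bitVectors (suc r) = map (false ∷_) (bitVectors r) ++ map (true ∷_) (bitVectors r)

evenLeadingList oddLeadingList : ∀ r → List (Vec Bool r)
evenLeadingList zero    = [] ∷ []
evenLeadingList (suc r) = map (false ∷_) (bitVectors r) ++ map (true ∷_) (oddLeadingList r)
oddLeadingList zero    = []
oddLeadingList (suc r) = map (true ∷_) (evenLeadingList r)

seedList upperSeedList : ∀ r → List (BFVertex r)
seedList r = map bottom (evenLeadingList r) ++ upperSeedList r
upperSeedList zero    = []
upperSeedList (suc r) = map (copy false) (seedList r) ++ map (copy true) (upperSeedList r)

∈-bitVectors : ∀ {r} (y : Vec Bool r) → y ∈ bitVectors r
∈-bitVectors []          = here refl
∈-bitVectors (false ∷ y) = ∈-++⁺ˡ (∈-map⁺ (false ∷_) (∈-bitVectors y))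
∈-bitVectors (true ∷ y)  = ∈-++⁺ʳ _ (∈-map⁺ (true ∷_) (∈-bitVectors y))

∈-evenLeadingList : ∀ {r} (y : Vec Bool r) → evenLeadingOnes y ≡ true → y ∈ evenLeadingList r
∈-oddLeadingList  : ∀ {r} (y : Vec Bool r) → evenLeadingOnes y ≡ false → y ∈ oddLeadingList r
∈-evenLeadingList []          _    = here refl
∈-evenLeadingList (false ∷ y) _    = ∈-++⁺ˡ (∈-map⁺ (false ∷_) (∈-bitVectors y))
∈-evenLeadingList (true ∷ y)  even = ∈-++⁺ʳ _ (∈-map⁺ (true ∷_) (∈-oddLeadingList y (Bool.not-injective even)))
∈-oddLeadingList  (true ∷ y)  odd  = ∈-map⁺ (true ∷_) (∈-evenLeadingList y (Bool.not-injective odd))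

∈-seedList      : ∀ {r} (v : BFVertex r) → isSeed v ≡ true → v ∈ seedList r
∈-upperSeedList : ∀ {r} (i : Fin r) (y : Vec Bool r) → isSeed (fsuc i , y) ≡ true →
                  (fsuc i , y) ∈ upperSeedList r
∈-seedList (fzero , y) seed = ∈-++⁺ˡ (∈-map⁺ bottom (∈-evenLeadingList y seed))
∈-seedList {r} (fsuc i , y) seed = ∈-++⁺ʳ (map bottom (evenLeadingList r)) (∈-upperSeedList i y seed)
∈-upperSeedList {suc r} i (false ∷ y) seed = ∈-++⁺ˡ (∈-map⁺ (copy false) (∈-seedList (i , y) seed))
∈-upperSeedList {suc r} (fsuc i) (true ∷ y) seed =
  ∈-++⁺ʳ (map (copy false) (seedList r)) (∈-map⁺ (copy true) (∈-upperSeedList i y seed))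

length-map-++ : ∀ {a b c} {A : Set a} {B : Set b} {C : Set c} (f : A → C) (g : B → C) xs ys →
                length (map f xs ++ map g ys) ≡ length xs + length ys
length-map-++ f g xs ys = trans (length-++ (map f xs)) (cong₂ _+_ (length-map f xs) (length-map g ys))

2^n+2^n≡2^[1+n] : ∀ n → 2 ^ n + 2 ^ n ≡ 2 ^ suc n
2^n+2^n≡2^[1+n] n = cong (λ m → 2 ^ n + m) (sym (+-identityʳ (2 ^ n)))

length-bitVectors : ∀ r → length (bitVectors r) ≡ 2 ^ r
length-bitVectors zero    = refl
length-bitVectors (suc r) = begin
  length (bitVectors (suc r))                   ≡⟨ length-map-++ _ _ (bitVectors r) (bitVectors r) ⟩
  length (bitVectors r) + length (bitVectors r) ≡⟨ cong₂ _+_ (length-bitVectors r) (length-bitVectors r) ⟩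
  2 ^ r + 2 ^ r                                 ≡⟨ 2^n+2^n≡2^[1+n] r ⟩
  2 ^ suc r                                     ∎
  where open ≡-Reasoning

length-evenLeadingList-suc : ∀ r → length (evenLeadingList (suc r)) ≡ 2 ^ r + length (oddLeadingList r)
length-evenLeadingList-suc r =
  trans (length-map-++ _ _ (bitVectors r) (oddLeadingList r)) (cong (λ n → n + length (oddLeadingList r)) (length-bitVectors r))

length-oddLeadingList-suc : ∀ r → length (oddLeadingList (suc r)) ≡ length (evenLeadingList r)
length-oddLeadingList-suc r = length-map _ (evenLeadingList r)

length-seedList : ∀ r → length (seedList r) ≡ length (evenLeadingList r) + length (upperSeedList r)
length-seedList r =
  trans (length-++ (map bottom (evenLeadingList r))) (cong (λ n → n + length (upperSeedList r)) (length-map _ (evenLeadingList r)))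

length-upperSeedList-suc : ∀ r → length (upperSeedList (suc r)) ≡ length (seedList r) + length (upperSeedList r)
length-upperSeedList-suc r = length-map-++ _ _ (seedList r) (upperSeedList r)

length-evenLeading+oddLeading : ∀ r → length (evenLeadingList r) + length (oddLeadingList r) ≡ 2 ^ r
length-evenLeading+oddLeading zero    = refl
length-evenLeading+oddLeading (suc r) = begin
  length (evenLeadingList (suc r)) + length (oddLeadingList (suc r))
    ≡⟨ cong₂ _+_ (length-evenLeadingList-suc r) (length-oddLeadingList-suc r) ⟩
  (2 ^ r + O) + E  ≡⟨ swap (2 ^ r) O E ⟩
  2 ^ r + (E + O)  ≡⟨ cong (λ n → 2 ^ r + n) (length-evenLeading+oddLeading r) ⟩
  2 ^ r + 2 ^ r    ≡⟨ 2^n+2^n≡2^[1+n] r ⟩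
  2 ^ suc r        ∎
  where
  open ≡-Reasoning
  E = length (evenLeadingList r)
  O = length (oddLeadingList r)
  swap : ∀ p o e → (p + o) + e ≡ p + (e + o)
  swap = ℕ-Solver.solve-∀

length-evenLeading+evenLeading-suc : ∀ r → length (evenLeadingList r) + length (evenLeadingList (suc r)) ≡ 2 ^ suc r
length-evenLeading+evenLeading-suc r = begin
  E + E′ ≡⟨ +-comm E E′ ⟩
  E′ + E ≡⟨ cong (λ n → E′ + n) (sym (length-oddLeadingList-suc r)) ⟩
  E′ + length (oddLeadingList (suc r)) ≡⟨ length-evenLeading+oddLeading (suc r) ⟩
  2 ^ suc r ∎
  where
  open ≡-Reasoning
  E  = length (evenLeadingList r)
  E′ = length (evenLeadingList (suc r))

3*length-upperSeedList : ∀ r → 3 * length (upperSeedList r) + length (evenLeadingList r) ≡ suc r * 2 ^ r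
3*length-upperSeedList zero    = refl
3*length-upperSeedList (suc r) = begin
  3 * length (upperSeedList (suc r)) + length (evenLeadingList (suc r))
    ≡⟨ cong₂ (λ u e → 3 * u + e) (length-upperSeedList-suc r) (length-evenLeadingList-suc r) ⟩
  3 * (length (seedList r) + U) + (2 ^ r + O)
    ≡⟨ cong (λ s → 3 * (s + U) + (2 ^ r + O)) (length-seedList r) ⟩
  3 * ((E + U) + U) + (2 ^ r + O)  ≡⟨ regroup E U O (2 ^ r) ⟩
  2 * (3 * U + E) + (E + O) + 2 ^ r
    ≡⟨ cong₂ (λ a b → 2 * a + b + 2 ^ r) (3*length-upperSeedList r) (length-evenLeading+oddLeading r) ⟩
  2 * (suc r * 2 ^ r) + 2 ^ r + 2 ^ r  ≡⟨ collect r (2 ^ r) ⟩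
  suc (suc r) * 2 ^ suc r ∎
  where
  open ≡-Reasoning
  E = length (evenLeadingList r)
  O = length (oddLeadingList r)
  U = length (upperSeedList r)
  regroup : ∀ e u o p → 3 * ((e + u) + u) + (p + o) ≡ 2 * (3 * u + e) + (e + o) + p
  regroup = ℕ-Solver.solve-∀
  collect : ∀ r p → 2 * (suc r * p) + p + p ≡ suc (suc r) * (2 * p)
  collect = ℕ-Solver.solve-∀

9*length-seedList : ∀ r → 9 * length (seedList r) ≡ 3 * (suc r * 2 ^ r) + 2 * (3 * length (evenLeadingList r))
9*length-seedList r = begin
  9 * length (seedList r)      ≡⟨ cong (9 *_) (length-seedList r) ⟩
  9 * (E + U)                  ≡⟨ regroup E U ⟩
  3 * (3 * U + E) + 2 * (3 * E) ≡⟨ cong (λ x → 3 * x + 2 * (3 * E)) (3*length-upperSeedList r) ⟩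
  3 * (suc r * 2 ^ r) + 2 * (3 * E) ∎
  where
  open ≡-Reasoning
  E = length (evenLeadingList r)
  U = length (upperSeedList r)
  regroup : ∀ e u → 9 * (e + u) ≡ 3 * (3 * u + e) + 2 * (3 * e)
  regroup = ℕ-Solver.solve-∀

3*e≡2^[1+r]+[-1]^r : (e : ℕ → ℕ) → e 0 ≡ 1 → (∀ r → e r + e (suc r) ≡ 2 ^ suc r) →
                     ∀ r → + (3 * e r) ≡ + (2 ^ suc r) +ℤ -1ℤ ^ℤ r
3*e≡2^[1+r]+[-1]^r e e0 _   zero = cong (λ n → + (3 * n)) e0
3*e≡2^[1+r]+[-1]^r e e0 rec (suc r) = begin
  y                                      ≡⟨ cancel x y ⟩
  (x +ℤ y) -ℤ x                          ≡⟨ cong₂ _-ℤ_ sum (3*e≡2^[1+r]+[-1]^r e e0 rec r) ⟩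
  + (3 * Q) -ℤ (+ Q +ℤ σ)                ≡⟨ cong (λ z → z -ℤ (+ Q +ℤ σ)) (pos-* 3 Q) ⟩
  + 3 *ℤ + Q -ℤ (+ Q +ℤ σ)               ≡⟨ collect (+ Q) σ ⟩
  + 2 *ℤ + Q +ℤ -1ℤ *ℤ σ                 ≡⟨ cong (_+ℤ -1ℤ *ℤ σ) (sym (pos-* 2 Q)) ⟩
  + (2 ^ suc (suc r)) +ℤ -1ℤ ^ℤ suc r    ∎
  where
  open ≡-Reasoning
  Q = 2 ^ suc r
  σ = -1ℤ ^ℤ r
  x = + (3 * e r)
  y = + (3 * e (suc r))
  sum : x +ℤ y ≡ + (3 * Q)
  sum = trans (sym (pos-+ (3 * e r) _)) (cong +_ (trans (sym (*-distribˡ-+ 3 (e r) _)) (cong (3 *_) (rec r))))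
  cancel : ∀ x y → y ≡ (x +ℤ y) -ℤ x
  cancel = ℤ-Solver.solve-∀
  collect : ∀ q s → + 3 *ℤ q -ℤ (q +ℤ s) ≡ + 2 *ℤ q +ℤ -1ℤ *ℤ s
  collect = ℤ-Solver.solve-∀

9*length-seedList≡ : ∀ r → + (9 * length (seedList r)) ≡ + ((3 * r + 7) * 2 ^ r) +ℤ + 2 *ℤ (-[1+ 0 ] ^ℤ r)
9*length-seedList≡ r = begin
  + (9 * length (seedList r))                 ≡⟨ cong +_ (9*length-seedList r) ⟩
  + (3 * X + 2 * (3 * E))                     ≡⟨ pos-+-2* (3 * X) (3 * E) ⟩
  + (3 * X) +ℤ + 2 *ℤ + (3 * E)               ≡⟨ cong (λ z → + (3 * X) +ℤ + 2 *ℤ z) 3E≡ ⟩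
  + (3 * X) +ℤ + 2 *ℤ (+ (2 * P) +ℤ σ)        ≡⟨ regroup (+ (3 * X)) (+ (2 * P)) σ ⟩
  (+ (3 * X) +ℤ + 2 *ℤ + (2 * P)) +ℤ + 2 *ℤ σ ≡⟨ cong (_+ℤ + 2 *ℤ σ) (sym (pos-+-2* (3 * X) (2 * P))) ⟩
  + (3 * X + 2 * (2 * P)) +ℤ + 2 *ℤ σ         ≡⟨ cong (λ n → + n +ℤ + 2 *ℤ σ) (collect r P) ⟩
  + ((3 * r + 7) * P) +ℤ + 2 *ℤ σ             ∎
  where
  open ≡-Reasoning
  P = 2 ^ r
  X = suc r * P
  E = length (evenLeadingList r)
  σ = -1ℤ ^ℤ r
  3E≡ : + (3 * E) ≡ + (2 * P) +ℤ σ
  3E≡ = 3*e≡2^[1+r]+[-1]^r (length ∘ evenLeadingList) refl length-evenLeading+evenLeading-suc r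
  pos-+-2* : ∀ a b → + (a + 2 * b) ≡ + a +ℤ + 2 *ℤ + b
  pos-+-2* a b = trans (pos-+ a (2 * b)) (cong (λ z → + a +ℤ z) (pos-* 2 b))
  regroup : ∀ a b s → a +ℤ + 2 *ℤ (b +ℤ s) ≡ (a +ℤ + 2 *ℤ b) +ℤ + 2 *ℤ s
  regroup = ℤ-Solver.solve-∀
  collect : ∀ r p → 3 * (suc r * p) + 2 * (2 * p) ≡ (3 * r + 7) * p
  collect = ℕ-Solver.solve-∀

_≟BF_ : ∀ {r} → DecidableEquality (BFVertex r)
_≟BF_ = Product.≡-dec Fin._≟_ (Vec.≡-dec Bool._≟_)

proposition3p5 : (r : ℕ) → 1 ≤ r →
    Σ ℕ λ k → ZeroForcingNumber≤ (BFAdj r) k ×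
      (+ (9 * k) ≤ℤ (+ ((3 * r + 7) * 2 ^ r) +ℤ (+ 2) *ℤ (-[1+ 0 ] ^ℤ r)))
proposition3p5 r _ =
  length (seedList r) ,
  zeroForcingNumber≤length _≟BF_ (seedList r)
    (λ v → ActivelyColored⇒Colored (∈-seedList _) (BF-colored r v)) ,
  ≤-reflexive (9*length-seedList≡ r)
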